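{- Let $G=(V,E)$ be any $n$-vertex graph, not necessarily bipartite, and $\alpha\in(0,1)$. Then any subgraph $H$ of $G$ that is an $\alpha$-hitting set of $G$ is also an $\alpha$-matching cover of $G$.
   Context: For a graph $G$, $\mu(G)$ is its maximum matching size; for disjoint vertex subsets $A,B$, $G[A,B]$ is the bipartite subgraph of edges between $A$ and $B$. A subgraph $H$ of $G$ is an $\alpha$-hitting set of $G$ if for all disjoint $A,B\subseteq V$ with $|A|=|B|=\alpha n$ and $\mu(G[A,B])=\alpha n$, there is at least one edge of $H$ between $A$ and $B$. $H$ is an $\alpha$-matching cover of $G$ if for all disjoint $A,B\subseteq V$, $\mu(H[A,B])\ge\mu(G[A,B])-\alpha n$. -}

module Defs where

open import Data.Nat using (ℕ; _≤_; _+_)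
open import Data.Fin using (Fin)
open import Data.Fin.Subset using (Subset; _∈_)
open import Data.Product using (Σ; ∃; _×_)
open import Relation.Binary.PropositionalEquality using (_≡_)
open import Relation.Nullary using (¬_)
open import Function.Definitions using (Injective)

record Graph (n : ℕ) : Set₁ where
  field
    Adj   : Fin n → Fin n → Set
    sym   : ∀ {u v} → Adj u v → Adj v u
    irrefl : ∀ {u} → ¬ Adj u u
open Graph public

_⊆G_ : ∀ {n} → Graph n → Graph n → Set
H ⊆G G = ∀ {u v} → Adj H u v → Adj G u v

-- A matching of size m in the bipartite subgraph G[A,B]: m edges a i — b i
-- with a i ∈ A, b i ∈ B, and the endpoints pairwise distinct on each side.
-- (Since A and B are disjoint, the edges are then pairwise vertex-disjoint.)
record Matching {n : ℕ} (G : Graph n) (A B : Subset n) (m : ℕ) : Set where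
  field
    left   : Fin m → Fin n
    right  : Fin m → Fin n
    leftInj  : Injective _≡_ _≡_ left
    rightInj : Injective _≡_ _≡_ right
    leftIn   : ∀ i → left i ∈ A
    rightIn  : ∀ i → right i ∈ B
    isEdge   : ∀ i → Adj G (left i) (right i)

IsMu : ∀ {n} → Graph n → Subset n → Subset n → ℕ → Set
IsMu G A B m = Matching G A B m × (∀ m' → Matching G A B m' → m' ≤ m)

EdgeBetween : ∀ {n} → Graph n → Subset n → Subset n → Set
EdgeBetween H A B = ∃ λ u → ∃ λ v → u ∈ A × v ∈ B × Adj H u v

Disjoint : ∀ {n} → Subset n → Subset n → Set
Disjoint A B = ∀ v → v ∈ A → ¬ (v ∈ B)

-- Let a i — b i (i < mG) be a maximum matching of G[A,B] and call indices i, j crossing if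
-- a i — b j is an edge of H.  For any k indices, their a's and their b's are disjoint
-- k-sets carrying a perfect G-matching, so the hitting property yields a crossing pair
-- among them.  In the bipartite "crossing" graph on two copies of the indices, every
-- k-set thus contains an edge from its left copy to its right copy, which forces a
-- matching of size mG − k + 1: alternating-path augmentation needs only k left-free
-- indices and uses up at most one of them per step.  That matching is an H-matching in
-- H[A,B], so mG ≤ mH + k.
module Submission where

open import Defs hiding (sym)
open import Data.Nat using (ℕ; zero; suc; _≤_; _+_; _≤?_)
open import Data.Nat.Properties
  using (≤-trans; ≤-reflexive; ≰⇒>; 1+n≰n; m≤m+n; m≤n⇒m≤1+n; +-suc; +-assoc; m≤n⇒∃[o]m+o≡n)
open import Data.Fin using (Fin; zero; suc; punchIn; inject≤)
open import Data.Fin.Properties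
  using (_≟_; any?; suc-injective; 0≢1+n; punchIn-injective; punchInᵢ≢i; inject≤-injective)
open import Data.Fin.Subset using (Subset; _∈_; _∉_; _⊆_; ∣_∣; ⁅_⁆; _∪_; ⊥; inside; outside)
open import Data.Fin.Subset.Properties
  using (x∈p∪q⁺; x∈p∪q⁻; x∈⁅x⁆; x∈⁅y⁆⇒x≡y; ∉⊥; ∣⊥∣≡0; ∪-identityˡ; p⊆q⇒∣p∣≤∣q∣)
open import Data.Fin.Permutation.Components using (transpose; transpose-inverse)
open import Data.Vec.Base using (_∷_; here; there)
import Data.Vec.Functional as Vector
open import Data.Rational using (ℚ; _<_; _*_; _/_; 0ℚ; 1ℚ)
open import Data.Integer using (+_)
open import Data.Product using (Σ; ∃; ∃₂; _×_; _,_; proj₁; proj₂; map)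
open import Data.Sum using (inj₁; inj₂)
open import Data.Unit using (⊤; tt)
open import Function using (_∘_; id)
open import Function.Definitions using (Injective)
open import Relation.Nullary using (Dec; yes; no; contradiction)
open import Relation.Binary.PropositionalEquality using (_≡_; _≢_; refl; sym; trans; cong; subst; ≢-sym)

image : ∀ {k n} → (Fin k → Fin n) → Subset n
image {zero}  f = ⊥
image {suc k} f = ⁅ f zero ⁆ ∪ image (f ∘ suc)

∈-image : ∀ {k n} (f : Fin k → Fin n) i → f i ∈ image f
∈-image f zero    = x∈p∪q⁺ (inj₁ (x∈⁅x⁆ (f zero)))
∈-image f (suc i) = x∈p∪q⁺ (inj₂ (∈-image (f ∘ suc) i))

∈-image⁻ : ∀ {k n} (f : Fin k → Fin n) {x} → x ∈ image f → ∃ λ i → f i ≡ x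
∈-image⁻ {zero}  f x∈ = contradiction x∈ ∉⊥
∈-image⁻ {suc k} f x∈ with x∈p∪q⁻ ⁅ f zero ⁆ (image (f ∘ suc)) x∈
... | inj₁ x∈⁅f0⁆ = zero , sym (x∈⁅y⁆⇒x≡y (f zero) x∈⁅f0⁆)
... | inj₂ x∈rest = map suc id (∈-image⁻ (f ∘ suc) x∈rest)

image-⊆ : ∀ {k n} {f : Fin k → Fin n} {p : Subset n} → (∀ i → f i ∈ p) → image f ⊆ p
image-⊆ {f = f} f∈p x∈ with ∈-image⁻ f x∈
... | i , refl = f∈p i

∣⁅x⁆∪p∣≡1+∣p∣ : ∀ {n} {x : Fin n} {p : Subset n} → x ∉ p → ∣ ⁅ x ⁆ ∪ p ∣ ≡ suc ∣ p ∣
∣⁅x⁆∪p∣≡1+∣p∣ {suc n} {zero}  {outside ∷ p} _   = cong (suc ∘ ∣_∣) (∪-identityˡ p)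
∣⁅x⁆∪p∣≡1+∣p∣ {suc n} {zero}  {inside  ∷ p} x∉p = contradiction here x∉p
∣⁅x⁆∪p∣≡1+∣p∣ {suc n} {suc x} {outside ∷ p} x∉p = ∣⁅x⁆∪p∣≡1+∣p∣ (x∉p ∘ there)
∣⁅x⁆∪p∣≡1+∣p∣ {suc n} {suc x} {inside  ∷ p} x∉p = cong suc (∣⁅x⁆∪p∣≡1+∣p∣ (x∉p ∘ there))

∣image∣≡ : ∀ {k n} (f : Fin k → Fin n) → Injective _≡_ _≡_ f → ∣ image f ∣ ≡ k
∣image∣≡ {zero}  {n} f _     = ∣⊥∣≡0 n
∣image∣≡ {suc k}     f f-inj =
  trans (∣⁅x⁆∪p∣≡1+∣p∣ f0∉rest) (cong suc (∣image∣≡ (f ∘ suc) (suc-injective ∘ f-inj)))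
  where
  f0∉rest : f zero ∉ image (f ∘ suc)
  f0∉rest f0∈ = 0≢1+n (f-inj (sym (proj₂ (∈-image⁻ (f ∘ suc) f0∈))))

injective⇒≤∣p∣ : ∀ {k n} {f : Fin k → Fin n} {p : Subset n} →
                 Injective _≡_ _≡_ f → (∀ i → f i ∈ p) → k ≤ ∣ p ∣
injective⇒≤∣p∣ {f = f} f-inj f∈p =
  ≤-trans (≤-reflexive (sym (∣image∣≡ f f-inj))) (p⊆q⇒∣p∣≤∣q∣ (image-⊆ f∈p))

punchIn-avoiding : ∀ {r n} (f : Fin (suc r) → Fin n) → Injective _≡_ _≡_ f → (x : Fin n) →
                   ∃ λ i₀ → ∀ i → f (punchIn i₀ i) ≢ x
punchIn-avoiding f f-inj x with any? (λ i₀ → f i₀ ≟ x)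
... | yes (i₀ , f-i₀≡x) = i₀ , λ i eq → punchInᵢ≢i i₀ i (f-inj (trans eq (sym f-i₀≡x)))
... | no x∉f            = zero , λ i eq → x∉f (punchIn zero i , eq)

cons-avoids : ∀ {n m} {f : Fin n → Fin m} {x v : Fin m} →
              x ≢ v → (∀ i → f i ≢ v) → ∀ i → (x Vector.∷ f) i ≢ v
cons-avoids x≢v _   zero    = x≢v
cons-avoids _   f≢v (suc i) = f≢v i

cons-injective : ∀ {n m} {f : Fin n → Fin m} {x : Fin m} →
                 (∀ i → f i ≢ x) → Injective _≡_ _≡_ f → Injective _≡_ _≡_ (x Vector.∷ f)
cons-injective f≢x f-inj {zero}  {zero}  _  = refl
cons-injective f≢x f-inj {zero}  {suc j} eq = contradiction (sym eq) (f≢x j)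
cons-injective f≢x f-inj {suc i} {zero}  eq = contradiction eq (f≢x i)
cons-injective f≢x f-inj {suc i} {suc j} eq = cong suc (f-inj eq)

transpose-injective : ∀ {n} (i j : Fin n) → Injective _≡_ _≡_ (transpose i j)
transpose-injective i j eq =
  trans (sym (transpose-inverse j i)) (trans (cong (transpose j i) eq) (transpose-inverse j i))

transpose-at : ∀ {n} (i j : Fin n) → transpose i j i ≡ j
transpose-at i j with i ≟ i
... | yes _  = refl
... | no i≢i = contradiction refl i≢i

transpose-away : ∀ {n} {i j x : Fin n} → x ≢ i → x ≢ j → transpose i j x ≡ x
transpose-away {i = i} {j} {x} x≢i x≢j with x ≟ i
... | yes x≡i = contradiction x≡i x≢i
... | no _ with x ≟ j
...   | yes x≡j = contradiction x≡j x≢j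
...   | no _    = refl

-- A matching in the bipartite graph with two copies of Fin m as sides and R as edge
-- relation (so left i and right i may be the same vertex), with all endpoints in W.
record RelMatching {m : ℕ} (R : Fin m → Fin m → Set) (W : Fin m → Set) (s : ℕ) : Set where
  field
    left right      : Fin s → Fin m
    left-injective  : Injective _≡_ _≡_ left
    right-injective : Injective _≡_ _≡_ right
    related         : ∀ i → R (left i) (right i)
    left∈W          : ∀ i → W (left i)
    right∈W         : ∀ i → W (right i)

open RelMatching

module _ {m : ℕ} {R : Fin m → Fin m → Set} where

  LeftFree : ∀ {W s} → RelMatching R W s → Fin m → Set
  LeftFree N v = ∀ i → left N i ≢ v

  RightFree : ∀ {W s} → RelMatching R W s → Fin m → Set
  RightFree N v = ∀ i → right N i ≢ v

  within : ∀ {W W′ s} (N : RelMatching R W s) →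
           (∀ i → W′ (left N i)) → (∀ i → W′ (right N i)) → RelMatching R W′ s
  within N left∈W′ right∈W′ = record
    { left = left N ; right = right N
    ; left-injective = left-injective N ; right-injective = right-injective N
    ; related = related N ; left∈W = left∈W′ ; right∈W = right∈W′ }

  reindex : ∀ {W s t} (N : RelMatching R W s) (f : Fin t → Fin s) → Injective _≡_ _≡_ f →
            RelMatching R W t
  reindex N f f-inj = record
    { left = left N ∘ f ; right = right N ∘ f
    ; left-injective = f-inj ∘ left-injective N ; right-injective = f-inj ∘ right-injective N
    ; related = related N ∘ f ; left∈W = left∈W N ∘ f ; right∈W = right∈W N ∘ f }

  extend : ∀ {W s x y} (N : RelMatching R W s) → R x y → W x → W y →
           LeftFree N x → RightFree N y → RelMatching R W (suc s)
  extend N r x∈W y∈W x-free y-free = record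
    { left = _ Vector.∷ left N ; right = _ Vector.∷ right N
    ; left-injective = cons-injective x-free (left-injective N)
    ; right-injective = cons-injective y-free (right-injective N)
    ; related = λ { zero → r ; (suc i) → related N i }
    ; left∈W = λ { zero → x∈W ; (suc i) → left∈W N i }
    ; right∈W = λ { zero → y∈W ; (suc i) → right∈W N i } }

  KeepsFreeExcept : ∀ {W W′ s s′} → RelMatching R W s → RelMatching R W′ s′ → Fin m → Set
  KeepsFreeExcept N N′ x = ∀ v → LeftFree N v → v ≢ x → LeftFree N′ v

module _ {m k : ℕ} {R : Fin m → Fin m → Set} where

  Augmentable : ℕ → Set₁
  Augmentable s = ∀ {W} (N : RelMatching R W s) (e : Fin k → Fin m) → Injective _≡_ _≡_ e →
                  (∀ a → W (e a)) → (∀ a → LeftFree N (e a)) →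
                  Σ (RelMatching R W (suc s)) λ N′ → ∃ (KeepsFreeExcept N N′)

  -- The edge u — w cannot be added because w is already matched to w′.  Drop that edge,
  -- let w′ replace w among the free vertices, augment recursively inside W ∖ {w}, and
  -- finally match w to whichever of w′ and u is still free.
  reroute : ∀ {s W} → Augmentable s →
            (N : RelMatching R W (suc s)) (e : Fin k → Fin m) → Injective _≡_ _≡_ e →
            (∀ a → W (e a)) → (∀ a → LeftFree N (e a)) →
            ∀ {i j} → R (e i) (e j) → (j₀ : Fin (suc s)) → right N j₀ ≡ e j →
            Σ (RelMatching R W (suc (suc s))) λ N′ → ∃ (KeepsFreeExcept N N′)
  reroute {s} {W} augment-s N e e-inj e∈W e-free {i} {j} r j₀ right-j₀≡w = result (w′ ≟ x₁)
    where
    u w w′ : Fin m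
    u  = e i
    w  = e j
    w′ = left N j₀

    W₁ : Fin m → Set
    W₁ v = W v × v ≢ w

    N₁ : RelMatching R W₁ s
    N₁ = within (reindex N (punchIn j₀) (punchIn-injective j₀ _ _))
           (λ a → left∈W N _ , e-free j _)
           (λ a → right∈W N _ , λ eq → punchInᵢ≢i j₀ a (right-injective N (trans eq (sym right-j₀≡w))))

    free₁ : ∀ v → LeftFree N v → LeftFree N₁ v
    free₁ v v-free a = v-free (punchIn j₀ a)

    w′-free₁ : LeftFree N₁ w′
    w′-free₁ a eq = punchInᵢ≢i j₀ a (left-injective N eq)

    e₁ : Fin k → Fin m
    e₁ = transpose w w′ ∘ e

    e₁-valid : ∀ a → W₁ (e₁ a) × LeftFree N₁ (e₁ a)
    e₁-valid a = by-cases (e a ≟ w)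
      where
      by-cases : Dec (e a ≡ w) → W₁ (e₁ a) × LeftFree N₁ (e₁ a)
      by-cases (yes e-a≡w) = subst (λ v → W₁ v × LeftFree N₁ v)
                               (sym (trans (cong (transpose w w′) e-a≡w) (transpose-at w w′)))
                               ((left∈W N j₀ , e-free j j₀) , w′-free₁)
      by-cases (no e-a≢w)  = subst (λ v → W₁ v × LeftFree N₁ v)
                               (sym (transpose-away e-a≢w (≢-sym (e-free a j₀))))
                               ((e∈W a , e-a≢w) , free₁ (e a) (e-free a))

    augmented : Σ (RelMatching R W₁ (suc s)) λ N′ → ∃ (KeepsFreeExcept N₁ N′)
    augmented = augment-s N₁ e₁ (e-inj ∘ transpose-injective w w′) (proj₁ ∘ e₁-valid) (proj₂ ∘ e₁-valid)

    N₂ : RelMatching R W (suc s)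
    N₂ = within (proj₁ augmented) (proj₁ ∘ left∈W (proj₁ augmented)) (proj₁ ∘ right∈W (proj₁ augmented))

    x₁ : Fin m
    x₁ = proj₁ (proj₂ augmented)

    w-right-free₂ : RightFree N₂ w
    w-right-free₂ a = proj₂ (right∈W (proj₁ augmented) a)

    keeps₂ : KeepsFreeExcept N N₂ x₁
    keeps₂ v v-free v≢x₁ with v ≟ w
    ... | yes v≡w = λ a eq → proj₂ (left∈W (proj₁ augmented) a) (trans eq v≡w)
    ... | no v≢w  = proj₂ (proj₂ augmented) v (free₁ v v-free) v≢x₁

    result : Dec (w′ ≡ x₁) → Σ (RelMatching R W (suc (suc s))) λ N′ → ∃ (KeepsFreeExcept N N′)
    result (no w′≢x₁) =
      extend N₂ (subst (R w′) right-j₀≡w (related N j₀)) (left∈W N j₀) (e∈W j)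
        (proj₂ (proj₂ augmented) w′ w′-free₁ w′≢x₁) w-right-free₂
      , x₁ , λ v v-free v≢x₁ → cons-avoids (v-free j₀) (keeps₂ v v-free v≢x₁)
    result (yes w′≡x₁) =
      extend N₂ r (e∈W i) (e∈W j) (keeps₂ u (e-free i) (free≢x₁ (e-free i))) w-right-free₂
      , u , λ v v-free v≢u → cons-avoids (≢-sym v≢u) (keeps₂ v v-free (free≢x₁ v-free))
      where
      free≢x₁ : ∀ {v} → LeftFree N v → v ≢ x₁
      free≢x₁ v-free v≡x₁ = v-free j₀ (trans w′≡x₁ (sym v≡x₁))

  module _ (hits : ∀ (e : Fin k → Fin m) → Injective _≡_ _≡_ e → ∃₂ λ i j → R (e i) (e j)) where

    augment : ∀ s → Augmentable s
    augment s N e e-inj e∈W e-free with hits e e-inj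
    ... | i , j , r with any? (λ j₀ → right N j₀ ≟ e j)
    ... | no e-j-free =
      extend N r (e∈W i) (e∈W j) (e-free i) (λ j₀ eq → e-j-free (j₀ , eq))
      , e i , λ v v-free v≢e-i → cons-avoids (≢-sym v≢e-i) v-free
    augment zero    N e e-inj e∈W e-free | i , j , r | yes (() , _)
    augment (suc s) N e e-inj e∈W e-free | i , j , r | yes (j₀ , right-j₀≡e-j) =
      reroute (augment s) N e e-inj e∈W e-free r j₀ right-j₀≡e-j

    record Stage (s r : ℕ) : Set where
      field
        matching       : RelMatching R (λ _ → ⊤) s
        free           : Fin r → Fin m
        free-injective : Injective _≡_ _≡_ free
        free-leftFree  : ∀ a → LeftFree matching (free a)

    open Stage

    nextStage : ∀ {s r} → k ≤ suc r → Stage s (suc r) → Stage (suc s) r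
    nextStage {s} k≤1+r st
      with augment s (matching st) (free st ∘ (λ a → inject≤ a k≤1+r))
             (inject≤-injective _ _ _ _ ∘ free-injective st) (λ _ → tt) (λ a → free-leftFree st _)
    ... | N′ , x , keeps with punchIn-avoiding (free st) (free-injective st) x
    ... | i₀ , avoids = record
      { matching = N′
      ; free = free st ∘ punchIn i₀
      ; free-injective = punchIn-injective i₀ _ _ ∘ free-injective st
      ; free-leftFree = λ a → keeps _ (free-leftFree st _) (avoids a) }

    stage : ∀ s {r} → k ≤ r → s + r ≡ m → Stage s r
    stage zero    k≤r refl = record
      { matching = record { left = λ () ; right = λ () ; left-injective = λ {} ; right-injective = λ {}
                          ; related = λ () ; left∈W = λ () ; right∈W = λ () }
      ; free = id ; free-injective = id ; free-leftFree = λ _ () }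
    stage (suc s) {r} k≤r s+r≡m =
      nextStage (m≤n⇒m≤1+n k≤r) (stage s (m≤n⇒m≤1+n k≤r) (trans (+-suc s r) s+r≡m))

    largeMatching : ∀ {s} → s + k ≤ m → RelMatching R (λ _ → ⊤) s
    largeMatching {s} s+k≤m with m≤n⇒∃[o]m+o≡n s+k≤m
    ... | o , s+k+o≡m = matching (stage s (m≤m+n k o) (trans (sym (+-assoc s k o)) s+k+o≡m))

disjoint-⊆ : ∀ {n} {A B A′ B′ : Subset n} → Disjoint A B → A′ ⊆ A → B′ ⊆ B → Disjoint A′ B′
disjoint-⊆ A#B A′⊆A B′⊆B v v∈A′ v∈B′ = A#B v (A′⊆A v∈A′) (B′⊆B v∈B′)

module _ {n : ℕ} {G : Graph n} where

  matching≤∣left∣ : ∀ {A B m} → Matching G A B m → m ≤ ∣ A ∣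
  matching≤∣left∣ M = injective⇒≤∣p∣ (Matching.leftInj M) (Matching.leftIn M)

  saturating⇒isMu : ∀ {A B k} → Matching G A B k → ∣ A ∣ ≡ k → IsMu G A B k
  saturating⇒isMu M ∣A∣≡k = M , λ m′ M′ → ≤-trans (matching≤∣left∣ M′) (≤-reflexive ∣A∣≡k)

  Hitting : Graph n → ℕ → Set
  Hitting H k = ∀ (A B : Subset n) → Disjoint A B → ∣ A ∣ ≡ k → ∣ B ∣ ≡ k →
                IsMu G A B k → EdgeBetween H A B

  module _ {A B : Subset n} {m : ℕ} (M : Matching G A B m) where
    open Matching M renaming (left to a; right to b)

    subMatching : ∀ {k} (e : Fin k → Fin m) → Injective _≡_ _≡_ e →
                  Matching G (image (a ∘ e)) (image (b ∘ e)) k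
    subMatching e e-inj = record
      { left = a ∘ e ; right = b ∘ e
      ; leftInj = e-inj ∘ leftInj ; rightInj = e-inj ∘ rightInj
      ; leftIn = ∈-image (a ∘ e) ; rightIn = ∈-image (b ∘ e)
      ; isEdge = isEdge ∘ e }

    Crossing : Graph n → Fin m → Fin m → Set
    Crossing H i j = Adj H (a i) (b j)

    crossing-inside : ∀ {H k} → Hitting H k → Disjoint A B →
                      ∀ (e : Fin k → Fin m) → Injective _≡_ _≡_ e → ∃₂ λ i j → Crossing H (e i) (e j)
    crossing-inside hit A#B e e-inj
      with hit (image (a ∘ e)) (image (b ∘ e))
             (disjoint-⊆ A#B (image-⊆ (leftIn ∘ e)) (image-⊆ (rightIn ∘ e)))
             ∣A′∣≡k (∣image∣≡ (b ∘ e) (e-inj ∘ rightInj))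
             (saturating⇒isMu (subMatching e e-inj) ∣A′∣≡k)
      where
      ∣A′∣≡k = ∣image∣≡ (a ∘ e) (e-inj ∘ leftInj)
    ... | u , v , u∈A′ , v∈B′ , uv∈H with ∈-image⁻ (a ∘ e) u∈A′ | ∈-image⁻ (b ∘ e) v∈B′
    ... | i , refl | j , refl = i , j , uv∈H

    toMatching : ∀ {H W s} → RelMatching (Crossing H) W s → Matching H A B s
    toMatching N = record
      { left = a ∘ RelMatching.left N ; right = b ∘ RelMatching.right N
      ; leftInj = RelMatching.left-injective N ∘ leftInj
      ; rightInj = RelMatching.right-injective N ∘ rightInj
      ; leftIn = leftIn ∘ RelMatching.left N ; rightIn = rightIn ∘ RelMatching.right N
      ; isEdge = RelMatching.related N }

lemma4p10 : (n : ℕ) (G H : Graph n) (α : ℚ) (k : ℕ) →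
    0ℚ < α → α < 1ℚ →
    α * (+ n / 1) ≡ (+ k / 1) →
    H ⊆G G →
    (∀ (A B : Subset n) → Disjoint A B → ∣ A ∣ ≡ k → ∣ B ∣ ≡ k →
      IsMu G A B k → EdgeBetween H A B) →
    (∀ (A B : Subset n) → Disjoint A B → (mG mH : ℕ) →
      IsMu G A B mG → IsMu H A B mH → mG ≤ mH + k)
lemma4p10 n G H α k _ _ _ _ hit A B A#B mG mH (MG , _) (MH , maximum) with mG ≤? mH + k
... | yes mG≤mH+k = mG≤mH+k
... | no  mG≰mH+k = contradiction (maximum (suc mH) larger) 1+n≰n
  where
  larger : Matching H A B (suc mH)
  larger = toMatching MG (largeMatching (crossing-inside MG {H = H} hit A#B) (≰⇒> mG≰mH+k))
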